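{- For $A\in\mathcal{PM}(n)$, $B\in\mathcal{PM}(m)$ and $i\in[n]$ let $\mathrm{Min}_i(A,B)$ be the $(n-i)\times m$ matrix whose $j$-th column equals $A^{(i)}$ if $j$ is a minimal element of the poset associated to $B$, and is the zero column otherwise, and define $$A\circ^{\min}_i B=\begin{pmatrix}A_{11}&\mathbb{O}&\mathbb{O}\\ \mathbb{1}_m^T\otimes A_{(i)}&B&\mathbb{O}\\ A_{21}&\mathrm{Min}_i(A,B)&A_{22}\end{pmatrix}.$$ Then the maps $\circ^{\min}_i$ endow $\mathcal{PM}=\bigsqcup_{n\ge1}\mathcal{PM}(n)$ with a set operad structure, that is: (a) $A\circ^{\min}_i B\in\mathcal{PM}(n+m-1)$ for all $A\in\mathcal{PM}(n)$, $B\in\mathcal{PM}(m)$, $i\in[n]$; (b) for all $A\in\mathcal{PM}(n)$, $B\in\mathcal{PM}(m)$, $C\in\mathcal{PM}(k)$, $i\in[n]$, $j\in[m]$: $(A\circ^{\min}_i B)\circ^{\min}_{i+j-1}C=A\circ^{\min}_i(B\circ^{\min}_j C)$; (c) for all $A\in\mathcal{PM}(n)$, $B\in\mathcal{PM}(m)$, $C\in\mathcal{PM}(k)$ and $1\le i<j\le n$: $(A\circ^{\min}_i B)\circ^{\min}_{j+m-1}C=(A\circ^{\min}_j C)\circ^{\min}_i B$; (d) $[1]\circ^{\min}_1 A=A\circ^{\min}_i[1]=A$ for all $A\in\mathcal{PM}(n)$, $i\in[n]$.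
   Context: A poset matrix of order $n$ is an $n\times n$ $(0,1)$-matrix $A=[a_{st}]$ that is lower triangular with all diagonal entries $1$ and transitive ($a_{st}=a_{tu}=1\Rightarrow a_{su}=1$); $\mathcal{PM}(n)$ is the set of these. The poset associated to $B=[b_{st}]\in\mathcal{PM}(m)$ is $[m]$ with $t\le s$ iff $b_{st}=1$; so $j$ is minimal iff row $j$ of $B$ has no $1$ left of the diagonal. $A[\alpha\mid\beta]$ is the submatrix with rows $\alpha$ and columns $\beta$, $A[\alpha]=A[\alpha\mid\alpha]$. For $A\in\mathcal{PM}(n)$, $i\in[n]$: $A_{11}=A[\{1,\dots,i-1\}]$, $A_{22}=A[\{i+1,\dots,n\}]$, $A_{21}=A[\{i+1,\dots,n\}\mid\{1,\dots,i-1\}]$, $A_{(i)}=A[\{i\}\mid\{1,\dots,i-1\}]$, $A^{(i)}=A[\{i+1,\dots,n\}\mid\{i\}]$; empty blocks are vacuous. $\mathbb{1}_m^T\otimes A_{(i)}$ is the $m\times(i-1)$ matrix all of whose rows equal $A_{(i)}$. -}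

module Defs where

open import Data.Nat using (ℕ; zero; suc; _+_; _∸_; _<_; _<ᵇ_; _<?_)
open import Data.Fin using (Fin; toℕ; fromℕ<)
open import Data.Bool using (Bool; true; false; not; _∨_; if_then_else_)
open import Data.Product using (_×_)
open import Relation.Binary.PropositionalEquality using (_≡_)
open import Relation.Nullary using (yes; no)

-- An n×n (0,1)-matrix, entries true = 1, false = 0; indices 0-based.
Mat : ℕ → Set
Mat n = Fin n → Fin n → Bool

IsPM : ∀ {n} → Mat n → Set
IsPM {n} A =
  (∀ (s t : Fin n) → toℕ s < toℕ t → A s t ≡ false) ×
  (∀ (s : Fin n) → A s s ≡ true) ×
  (∀ (s t u : Fin n) → A s t ≡ true → A t u ≡ true → A s u ≡ true)

at : ∀ {n} → Mat n → ℕ → ℕ → Bool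
at {n} A r c with r <? n | c <? n
... | yes p | yes q = A (fromℕ< p) (fromℕ< q)
... | _     | _     = false

anyBelow : (ℕ → Bool) → ℕ → Bool
anyBelow f zero = false
anyBelow f (suc k) = anyBelow f k ∨ f k

-- j (0-based) is minimal in the poset of B iff row j has no 1 left of the diagonal.
isMinimal : ∀ {m} → Mat m → ℕ → Bool
isMinimal B j = not (anyBelow (λ t → at B j t) j)

-- A ∘^min_i B, where i0 = i - 1 is the 0-based position of i.
-- Rows/columns x < i0 : block 1 (A index x);
-- i0 ≤ x < i0 + m   : block 2 (B index x - i0);
-- x ≥ i0 + m        : block 3 (A index x - m + 1).
compEntry : ∀ {a b} → Mat (suc a) → Mat (suc b) → ℕ → ℕ → ℕ → Bool
compEntry {a} {b} A B i0 r c =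
  if r <ᵇ i0 then
    (if c <ᵇ i0 then at A r c else false)
  else if r <ᵇ i0 + suc b then
    (if c <ᵇ i0 then at A i0 c
     else if c <ᵇ i0 + suc b then at B (r ∸ i0) (c ∸ i0)
     else false)
  else
    (if c <ᵇ i0 then at A (r ∸ b) c
     else if c <ᵇ i0 + suc b then
       (if isMinimal B (c ∸ i0) then at A (r ∸ b) i0 else false)
     else at A (r ∸ b) (c ∸ b))

compMin : ∀ {a b} → Mat (suc a) → ℕ → Mat (suc b) → Mat (suc (a + b))
compMin A i0 B r c = compEntry A B i0 (toℕ r) (toℕ c)

-- Equality of matrices possibly of (propositionally) different orders.
_≋_ : ∀ {n n'} → Mat n → Mat n' → Set
_≋_ {n} {n'} A A' = (n ≡ n') × (∀ (r c : ℕ) → at A r c ≡ at A' r c)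

one : Mat 1
one _ _ = true

{-# OPTIONS --safe #-}
module Submission where

-- Read matrices through `at` as ℕ-indexed entry functions vanishing outside the
-- matrix; there A ∘ᵢ B is `compose`. The indices of A ∘ᵢ B fall into three blocks
-- (before i, the copy of B, after it), and on each pair of blocks the entry is a
-- fixed entry of A or of B. Transitivity of the result is then a case analysis on
-- three blocks; the one real case is an A-element above a B-element y ≥ y′, where y
-- must be minimal in B, and a minimal element lies above nothing but itself.
-- For the associativity laws the indices fall into five blocks, and in each of the
-- 25 pairs both sides reduce to the same entry of A, B or C; the only input beyond
-- the block formulas is that minimality in B ∘ⱼ C is computed blockwise. These two
-- laws hold for arbitrary (0,1)-matrices.

open import Defs
open import Data.Bool using (Bool; true; false; not; _∨_; _∧_; if_then_else_)
open import Data.Bool.Properties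
  using (∨-assoc; ∨-identityʳ; ∨-zeroʳ; ∨-abs-∧; ∧-assoc; ∧-comm; ∧-zeroʳ; ∧-conicalˡ; ∧-conicalʳ; not-¬; ¬-not)
open import Data.Fin using (toℕ; fromℕ<)
open import Data.Fin.Properties using (toℕ<n; toℕ-fromℕ<)
open import Data.Nat using (ℕ; zero; suc; _+_; _∸_; _<_; _≤_; _<ᵇ_; _<?_; z<s; s≤s; s≤s⁻¹)
open import Data.Nat.Properties
open import Data.List using (_∷_; [])
open import Data.Nat.Tactic.RingSolver using (solve)
open import Data.Product using (_×_; _,_; proj₁; proj₂)
open import Data.Sum using (inj₁; inj₂)
open import Relation.Binary.Definitions using (tri<; tri≈; tri>)
open import Relation.Binary.PropositionalEquality
open import Relation.Nullary using (yes; no; ¬_; contradiction)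
open ≡-Reasoning

if-then-false : ∀ b x → (if b then x else false) ≡ b ∧ x
if-then-false true  x = refl
if-then-false false x = refl

not-∨ : ∀ x y → not (x ∨ y) ≡ not x ∧ not y
not-∨ true  y = refl
not-∨ false y = refl

<ᵇ-true : ∀ {m n} → m < n → (m <ᵇ n) ≡ true
<ᵇ-true {zero}  {suc n} _       = refl
<ᵇ-true {suc m} {suc n} (s≤s p) = <ᵇ-true p

<ᵇ-false : ∀ {m n} → n ≤ m → (m <ᵇ n) ≡ false
<ᵇ-false {m}     {zero}  _       = refl
<ᵇ-false {suc m} {suc n} (s≤s p) = <ᵇ-false p

anyBelow-cong : ∀ {f f′ : ℕ → Bool} k → (∀ t → t < k → f t ≡ f′ t) → anyBelow f k ≡ anyBelow f′ k
anyBelow-cong zero    eq = refl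
anyBelow-cong (suc k) eq = cong₂ _∨_ (anyBelow-cong k (λ t t<k → eq t (m<n⇒m<1+n t<k))) (eq k ≤-refl)

anyBelow-+ : ∀ (f : ℕ → Bool) m n → anyBelow f (m + n) ≡ anyBelow f m ∨ anyBelow (λ t → f (m + t)) n
anyBelow-+ f m zero    rewrite +-identityʳ m = sym (∨-identityʳ _)
anyBelow-+ f m (suc n) rewrite +-suc m n | anyBelow-+ f m n = ∨-assoc (anyBelow f m) _ _

anyBelow-suc : ∀ (f : ℕ → Bool) k → anyBelow f (suc k) ≡ f 0 ∨ anyBelow (λ t → f (suc t)) k
anyBelow-suc f zero    = sym (∨-identityʳ (f 0))
anyBelow-suc f (suc k) rewrite anyBelow-suc f k = ∨-assoc (f 0) _ _

anyBelow-witness : ∀ (f : ℕ → Bool) {k t} → t < k → f t ≡ true → anyBelow f k ≡ true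
anyBelow-witness f {suc k} t<k ft with m<1+n⇒m<n∨m≡n t<k
... | inj₁ t<k′ rewrite anyBelow-witness f t<k′ ft = refl
... | inj₂ refl rewrite ft = ∨-zeroʳ (anyBelow f k)

anyBelow-guarded : ∀ (p : ℕ → Bool) v c → p 0 ≡ true → anyBelow (λ t → p t ∧ v) (suc c) ≡ v
anyBelow-guarded p v zero    p0 rewrite p0 = refl
anyBelow-guarded p v (suc c) p0 rewrite anyBelow-guarded p v c p0 | ∧-comm (p (suc c)) v = ∨-abs-∧ v _

Entries : Set
Entries = ℕ → ℕ → Bool

isMin : Entries → ℕ → Bool
isMin g j = not (anyBelow (g j) j)

-- compEntry A B i is definitionally compose (at A) (at B) i b, for B of order suc b.
compose : Entries → Entries → ℕ → ℕ → Entries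
compose f g i b r c =
  if r <ᵇ i then
    (if c <ᵇ i then f r c else false)
  else if r <ᵇ i + suc b then
    (if c <ᵇ i then f i c
     else if c <ᵇ i + suc b then g (r ∸ i) (c ∸ i)
     else false)
  else
    (if c <ᵇ i then f (r ∸ b) c
     else if c <ᵇ i + suc b then
       (if isMin g (c ∸ i) then f (r ∸ b) i else false)
     else f (r ∸ b) (c ∸ b))

compose-congˡ : ∀ {f f′} g i b → (∀ r c → f r c ≡ f′ r c) → ∀ r c → compose f g i b r c ≡ compose f′ g i b r c
compose-congˡ g i b f≗f′ r c
  rewrite f≗f′ r c | f≗f′ i c | f≗f′ (r ∸ b) c | f≗f′ (r ∸ b) i | f≗f′ (r ∸ b) (c ∸ b) = refl

compose-congʳ : ∀ f {g g′} i b → (∀ r c → g r c ≡ g′ r c) → ∀ r c → compose f g i b r c ≡ compose f g′ i b r c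
compose-congʳ f {g} {g′} i b g≗g′ r c
  rewrite g≗g′ (r ∸ i) (c ∸ i) | anyBelow-cong {g (c ∸ i)} {g′ (c ∸ i)} (c ∸ i) (λ t _ → g≗g′ (c ∸ i) t) = refl

record IsPosetEntries (n : ℕ) (f : Entries) : Set where
  field
    triangular : ∀ r c → r < c → f r c ≡ false
    reflexive  : ∀ r → r < n → f r r ≡ true
    transitive : ∀ r s t → f r s ≡ true → f s t ≡ true → f r t ≡ true

Bounded : ℕ → Entries → Set
Bounded n f = ∀ r c → f r c ≡ true → r < n × c < n

bounded-outside : ∀ {n g} → Bounded n g → ∀ {r c} → ¬ (r < n × c < n) → g r c ≡ false
bounded-outside g-bounded {r} {c} out = ¬-not λ grc → out (g-bounded r c grc)

min-below⇒≡ : ∀ {n g} → IsPosetEntries n g → ∀ {y y′} → isMin g y ≡ true → g y y′ ≡ true → y ≡ y′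
min-below⇒≡ {g = g} Pg {y} {y′} min gyy′ with <-cmp y y′
... | tri< y<y′ _ _ = contradiction gyy′ (not-¬ (IsPosetEntries.triangular Pg y y′ y<y′))
... | tri≈ _ y≡y′ _ = y≡y′
... | tri> _ _ y′<y = contradiction min (not-¬ (cong not (anyBelow-witness (g y) y′<y gyy′)))

at-bounded : ∀ {n} (A : Mat n) → Bounded n (at A)
at-bounded {n} A r c _  with r <? n | c <? n
at-bounded     A r c _  | yes r<n | yes c<n = r<n , c<n
at-bounded     A r c () | yes _   | no  _
at-bounded     A r c () | no  _   | _

at-fromℕ< : ∀ {n} (A : Mat n) {r c} (r<n : r < n) (c<n : c < n) → at A r c ≡ A (fromℕ< r<n) (fromℕ< c<n)
at-fromℕ< {n} A {r} {c} r<n c<n with r <? n | c <? n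
... | yes _    | yes _    = refl
... | yes _    | no  c≮n  = contradiction c<n c≮n
... | no  r≮n  | _        = contradiction r<n r≮n

IsPM⇒IsPosetEntries : ∀ {n} {A : Mat n} → IsPM A → IsPosetEntries n (at A)
IsPM⇒IsPosetEntries {n} {A} (triangular , reflexive , transitive) = record
  { triangular = T ; reflexive = R ; transitive = Tr }
  where
  T : ∀ r c → r < c → at A r c ≡ false
  T r c r<c with r <? n | c <? n
  ... | yes r<n | yes c<n = triangular _ _ (subst₂ _<_ (sym (toℕ-fromℕ< r<n)) (sym (toℕ-fromℕ< c<n)) r<c)
  ... | yes _   | no  _   = refl
  ... | no  _   | _       = refl
  R : ∀ r → r < n → at A r r ≡ true
  R r r<n = trans (at-fromℕ< A r<n r<n) (reflexive _)
  Tr : ∀ r s t → at A r s ≡ true → at A s t ≡ true → at A r t ≡ true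
  Tr r s t Ars Ast with at-bounded A r s Ars | at-bounded A s t Ast
  ... | r<n , s<n | _ , t<n = trans (at-fromℕ< A r<n t<n)
    (transitive _ _ _ (trans (sym (at-fromℕ< A r<n s<n)) Ars) (trans (sym (at-fromℕ< A s<n t<n)) Ast))

IsPosetEntries⇒IsPM : ∀ {n} (M : Mat n) {f} → (∀ s t → M s t ≡ f (toℕ s) (toℕ t)) →
                      IsPosetEntries n f → IsPM M
IsPosetEntries⇒IsPM M M≗f Pf =
  (λ s t s<t → trans (M≗f s t) (triangular _ _ s<t)) ,
  (λ s → trans (M≗f s s) (reflexive _ (toℕ<n s))) ,
  (λ s t u Mst Mtu → trans (M≗f s u)
     (transitive _ _ _ (trans (sym (M≗f s t)) Mst) (trans (sym (M≗f t u)) Mtu)))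
  where open IsPosetEntries Pf

data Block (i b : ℕ) : ℕ → Set where
  before : ∀ {x} → x < i → Block i b x
  inside : ∀ y → y < suc b → Block i b (i + y)
  after  : ∀ z → Block i b (i + suc b + z)

block : ∀ i b r → Block i b r
block i b r with r <? i
... | yes r<i = before r<i
... | no r≮i with r <? i + suc b
...   | yes r<i+1+b = subst (Block i b) i+[r∸i]≡r (inside (r ∸ i) r∸i<1+b)
  where
  i+[r∸i]≡r : i + (r ∸ i) ≡ r
  i+[r∸i]≡r = m+[n∸m]≡n (≮⇒≥ r≮i)
  r∸i<1+b : r ∸ i < suc b
  r∸i<1+b = +-cancelˡ-< i (r ∸ i) (suc b) (subst (_< i + suc b) (sym i+[r∸i]≡r) r<i+1+b)
...   | no r≮i+1+b = subst (Block i b) (m+[n∸m]≡n (≮⇒≥ r≮i+1+b)) (after (r ∸ (i + suc b)))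

i≤i+1+b+z : ∀ i b z → i ≤ i + suc b + z
i≤i+1+b+z i b z = ≤-trans (m≤m+n i (suc b)) (m≤m+n (i + suc b) z)

i+1+b+z≡b+[i+1+z] : ∀ i b z → i + suc b + z ≡ b + (i + suc z)
i+1+b+z≡b+[i+1+z] i b z = solve (i ∷ b ∷ z ∷ [])

i+1+b+z∸b≡i+1+z : ∀ i b z → i + suc b + z ∸ b ≡ i + suc z
i+1+b+z∸b≡i+1+z i b z = trans (cong (_∸ b) (i+1+b+z≡b+[i+1+z] i b z)) (m+n∸m≡n b (i + suc z))

-- Block coordinates are passed as equations, so callers may supply them in any
-- arithmetically equal form.
module Blocks (f g : Entries) (i b : ℕ) where
  E : Entries
  E = compose f g i b

  before-before : ∀ {r c} → r < i → c < i → E r c ≡ f r c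
  before-before r<i c<i rewrite <ᵇ-true r<i | <ᵇ-true c<i = refl

  private
    before-≥ : ∀ {r c} → r < i → i ≤ c → E r c ≡ false
    before-≥ r<i i≤c rewrite <ᵇ-true r<i | <ᵇ-false i≤c = refl

  before-inside : ∀ {r c} y → r < i → c ≡ i + y → E r c ≡ false
  before-inside y r<i refl = before-≥ r<i (m≤m+n i y)

  before-after : ∀ {r c} z → r < i → c ≡ i + suc b + z → E r c ≡ false
  before-after z r<i refl = before-≥ r<i (i≤i+1+b+z i b z)

  inside-before : ∀ {r c} y → r ≡ i + y → y < suc b → c < i → E r c ≡ f i c
  inside-before y refl y<1+b c<i
    rewrite <ᵇ-false (m≤m+n i y) | <ᵇ-true (+-monoʳ-< i y<1+b) | <ᵇ-true c<i = refl

  inside-inside : ∀ {r c} y y′ → r ≡ i + y → c ≡ i + y′ → y < suc b → y′ < suc b → E r c ≡ g y y′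
  inside-inside y y′ refl refl y<1+b y′<1+b
    rewrite <ᵇ-false (m≤m+n i y) | <ᵇ-true (+-monoʳ-< i y<1+b)
          | <ᵇ-false (m≤m+n i y′) | <ᵇ-true (+-monoʳ-< i y′<1+b) | m+n∸m≡n i y | m+n∸m≡n i y′ = refl

  inside-after : ∀ {r c} y z → r ≡ i + y → y < suc b → c ≡ i + suc b + z → E r c ≡ false
  inside-after y z refl y<1+b refl
    rewrite <ᵇ-false (m≤m+n i y) | <ᵇ-true (+-monoʳ-< i y<1+b)
          | <ᵇ-false (i≤i+1+b+z i b z) | <ᵇ-false (m≤m+n (i + suc b) z) = refl

  after-before : ∀ {r c k} z → r ≡ i + suc b + z → c < i → k ≡ i + suc z → E r c ≡ f k c
  after-before z refl c<i refl
    rewrite <ᵇ-false (i≤i+1+b+z i b z) | <ᵇ-false (m≤m+n (i + suc b) z) | <ᵇ-true c<i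
          | i+1+b+z∸b≡i+1+z i b z = refl

  after-inside : ∀ {r c k} z y → r ≡ i + suc b + z → c ≡ i + y → y < suc b → k ≡ i + suc z →
                 E r c ≡ isMin g y ∧ f k i
  after-inside z y refl refl y<1+b refl
    rewrite <ᵇ-false (i≤i+1+b+z i b z) | <ᵇ-false (m≤m+n (i + suc b) z)
          | <ᵇ-false (m≤m+n i y) | <ᵇ-true (+-monoʳ-< i y<1+b) | i+1+b+z∸b≡i+1+z i b z | m+n∸m≡n i y
          = if-then-false (isMin g y) _

  after-after : ∀ {r c k k′} z z′ → r ≡ i + suc b + z → c ≡ i + suc b + z′ → k ≡ i + suc z → k′ ≡ i + suc z′ →
                E r c ≡ f k k′
  after-after z z′ refl refl refl refl
    rewrite <ᵇ-false (i≤i+1+b+z i b z) | <ᵇ-false (m≤m+n (i + suc b) z)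
          | <ᵇ-false (i≤i+1+b+z i b z′) | <ᵇ-false (m≤m+n (i + suc b) z′)
          | i+1+b+z∸b≡i+1+z i b z | i+1+b+z∸b≡i+1+z i b z′ = refl

module _ {a b : ℕ} {f g : Entries} {i : ℕ} (Pf : IsPosetEntries (suc a) f) (Pg : IsPosetEntries (suc b) g)
         (i<1+a : i < suc a) where
  open Blocks f g i b
  private
    module F = IsPosetEntries Pf
    module G = IsPosetEntries Pg

    from : ∀ {r s x} → E r s ≡ x → E r s ≡ true → x ≡ true
    from e h = trans (sym e) h

    via-f : ∀ {r t r′ s′ t′} → E r t ≡ f r′ t′ → f r′ s′ ≡ true → f s′ t′ ≡ true → E r t ≡ true
    via-f e h₁ h₂ = trans e (F.transitive _ _ _ h₁ h₂)

  compose-triangular : ∀ r c → r < c → E r c ≡ false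
  compose-triangular r c r<c with block i b r | block i b c
  ... | before r<i  | before c<i   = trans (before-before r<i c<i) (F.triangular r c r<c)
  ... | before r<i  | inside y _   = before-inside y r<i refl
  ... | before r<i  | after z      = before-after z r<i refl
  ... | inside y _  | before c<i   = contradiction (m≤m+n i y) (<⇒≱ (<-trans r<c c<i))
  ... | inside y p  | inside y′ q  =
    trans (inside-inside y y′ refl refl p q) (G.triangular y y′ (+-cancelˡ-< i y y′ r<c))
  ... | inside y p  | after z      = inside-after y z refl p refl
  ... | after z     | before c<i   = contradiction (i≤i+1+b+z i b z) (<⇒≱ (<-trans r<c c<i))
  ... | after z     | inside y y<1+b =
    contradiction r<c (≤⇒≯ (≤-trans (+-monoʳ-≤ i (<⇒≤ y<1+b)) (m≤m+n (i + suc b) z)))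
  ... | after z     | after z′     =
    trans (after-after z z′ refl refl refl refl)
          (F.triangular _ _ (+-monoʳ-< i (s≤s (+-cancelˡ-< (i + suc b) z z′ r<c))))

  compose-reflexive : ∀ r → r < suc (a + b) → E r r ≡ true
  compose-reflexive r r<n with block i b r
  ... | before r<i   = trans (before-before r<i r<i) (F.reflexive r (<-trans r<i i<1+a))
  ... | inside y y<1+b = trans (inside-inside y y refl refl y<1+b y<1+b) (G.reflexive y y<1+b)
  ... | after z      = trans (after-after z z refl refl refl refl) (F.reflexive _ i+1+z<1+a)
    where
    i+1+z<1+a : i + suc z < suc a
    i+1+z<1+a = s≤s (+-cancelˡ-≤ b _ _ (subst₂ _≤_ (i+1+b+z≡b+[i+1+z] i b z) (+-comm a b) (s≤s⁻¹ r<n)))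

  compose-transitive : ∀ r s t → E r s ≡ true → E s t ≡ true → E r t ≡ true
  compose-transitive r s t Ers Est with block i b r | block i b s | block i b t
  ... | before p   | inside y _  | _          = contradiction Ers (not-¬ (before-inside y p refl))
  ... | before p   | after z     | _          = contradiction Ers (not-¬ (before-after z p refl))
  ... | inside y p | after z     | _          = contradiction Ers (not-¬ (inside-after y z refl p refl))
  ... | _          | before q    | inside y _ = contradiction Est (not-¬ (before-inside y q refl))
  ... | _          | before q    | after z    = contradiction Est (not-¬ (before-after z q refl))
  ... | _          | inside y q  | after z    = contradiction Est (not-¬ (inside-after y z refl q refl))
  ... | before p   | before q    | before u   =
    via-f (before-before p u) (from (before-before p q) Ers) (from (before-before q u) Est)
  ... | inside y p | before q    | before u   =
    via-f (inside-before y refl p u) (from (inside-before y refl p q) Ers) (from (before-before q u) Est)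
  ... | inside y p | inside y′ q | before u   =
    trans (inside-before y refl p u) (from (inside-before y′ refl q u) Est)
  ... | inside y p | inside y′ q | inside y″ u =
    trans (inside-inside y y″ refl refl p u)
      (G.transitive _ _ _ (from (inside-inside y y′ refl refl p q) Ers) (from (inside-inside y′ y″ refl refl q u) Est))
  ... | after z    | before q    | before u   =
    via-f (after-before z refl u refl) (from (after-before z refl q refl) Ers) (from (before-before q u) Est)
  ... | after z    | inside y q  | before u   =
    via-f (after-before z refl u refl) (∧-conicalʳ _ _ (from (after-inside z y refl refl q refl) Ers))
      (from (inside-before y refl q u) Est)
  ... | after z    | inside y q  | inside y′ u =
    trans (after-inside z y′ refl refl u refl) (subst (λ w → isMin g w ∧ f _ i ≡ true) y≡y′ min∧f)
    where
    min∧f = from (after-inside z y refl refl q refl) Ers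
    y≡y′ = min-below⇒≡ Pg (∧-conicalˡ _ _ min∧f) (from (inside-inside y y′ refl refl q u) Est)
  ... | after z    | after z′    | before u   =
    via-f (after-before z refl u refl) (from (after-after z z′ refl refl refl refl) Ers)
      (from (after-before z′ refl u refl) Est)
  ... | after z    | after z′    | inside y u =
    trans (after-inside z y refl refl u refl)
      (cong₂ _∧_ (∧-conicalˡ _ _ min∧f′) (F.transitive _ _ _ (from (after-after z z′ refl refl refl refl) Ers)
                                                                (∧-conicalʳ _ _ min∧f′)))
    where
    min∧f′ = from (after-inside z′ y refl refl u refl) Est
  ... | after z    | after z′    | after z″   =
    via-f (after-after z z″ refl refl refl refl) (from (after-after z z′ refl refl refl refl) Ers)
      (from (after-after z′ z″ refl refl refl refl) Est)

  compose-isPosetEntries : IsPosetEntries (suc (a + b)) E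
  compose-isPosetEntries = record
    { triangular = compose-triangular ; reflexive = compose-reflexive ; transitive = compose-transitive }

module _ {a b : ℕ} {f : Entries} (g : Entries) {i : ℕ} (f-bounded : Bounded (suc a) f) (i<1+a : i < suc a) where
  open Blocks f g i b
  private
    before-bound : ∀ {x} → x < i → x < suc (a + b)
    before-bound x<i = ≤-trans (<-trans x<i i<1+a) (s≤s (m≤m+n a b))

    inside-bound : ∀ {y} → y < suc b → i + y < suc (a + b)
    inside-bound y<1+b = s≤s (+-mono-≤ (s≤s⁻¹ i<1+a) (s≤s⁻¹ y<1+b))

    after-bound : ∀ z → i + suc z < suc a → i + suc b + z < suc (a + b)
    after-bound z k<1+a =
      s≤s (subst₂ _≤_ (sym (i+1+b+z≡b+[i+1+z] i b z)) (+-comm b a) (+-monoʳ-≤ b (s≤s⁻¹ k<1+a)))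

    row-bound : ∀ {r c k} → E r c ≡ f k c → E r c ≡ true → k < suc a
    row-bound e Erc = proj₁ (f-bounded _ _ (trans (sym e) Erc))

  compose-bounded : Bounded (suc (a + b)) E
  compose-bounded r c Erc with block i b r | block i b c
  ... | before p   | before q   = before-bound p , before-bound q
  ... | before p   | inside y _ = contradiction Erc (not-¬ (before-inside y p refl))
  ... | before p   | after z    = contradiction Erc (not-¬ (before-after z p refl))
  ... | inside y p | before q   = inside-bound p , before-bound q
  ... | inside y p | inside _ q = inside-bound p , inside-bound q
  ... | inside y p | after z    = contradiction Erc (not-¬ (inside-after y z refl p refl))
  ... | after z    | before q   = after-bound z (row-bound (after-before z refl q refl) Erc) , before-bound q
  ... | after z    | inside y q =
    after-bound z (proj₁ (f-bounded _ _ (∧-conicalʳ _ _ (trans (sym (after-inside z y refl refl q refl)) Erc)))) ,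
    inside-bound q
  ... | after z    | after z′   = after-bound z (proj₁ f-bound) , after-bound z′ (proj₂ f-bound)
    where f-bound = f-bounded _ _ (trans (sym (after-after z z′ refl refl refl refl)) Erc)

at-compMin : ∀ {a b} (A : Mat (suc a)) (B : Mat (suc b)) {i} → i < suc a →
             ∀ r c → at (compMin A i B) r c ≡ compose (at A) (at B) i b r c
at-compMin {a} {b} A B {i} i<1+a r c with r <? suc (a + b) | c <? suc (a + b)
... | yes r<n | yes c<n = cong₂ (compose (at A) (at B) i b) (toℕ-fromℕ< r<n) (toℕ-fromℕ< c<n)
... | yes _   | no  c≮n = sym (¬-not λ Erc → c≮n (proj₂ (compose-bounded (at B) (at-bounded A) i<1+a r c Erc)))
... | no  r≮n | _       = sym (¬-not λ Erc → r≮n (proj₁ (compose-bounded (at B) (at-bounded A) i<1+a r c Erc)))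

compMin-isPM : ∀ {a b} {A : Mat (suc a)} {B : Mat (suc b)} {i} → i < suc a →
               IsPM A → IsPM B → IsPM (compMin A i B)
compMin-isPM {A = A} {B} {i} i<1+a pmA pmB = IsPosetEntries⇒IsPM (compMin A i B) (λ _ _ → refl)
  (compose-isPosetEntries (IsPM⇒IsPosetEntries pmA) (IsPM⇒IsPosetEntries pmB) i<1+a)

module _ {b : ℕ} {g : Entries} (g-bounded : Bounded (suc b) g) where
  open Blocks (at one) g 0 b
  private
    one-outside : ∀ z {c} → at one (suc z) c ≡ false
    one-outside z {c} = bounded-outside (at-bounded one) {suc z} {c} λ { (s≤s () , _) }

    g-row-outside : ∀ z {c} → g (suc b + z) c ≡ false
    g-row-outside z {c} = bounded-outside g-bounded {suc b + z} {c} λ (r<1+b , _) → m+n≮m (suc b) z r<1+b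

  compose-unitˡ : ∀ r c → E r c ≡ g r c
  compose-unitˡ r c with block 0 b r | block 0 b c
  ... | before ()  | _
  ... | inside _ _ | before ()
  ... | after _    | before ()
  ... | inside y p | inside y′ q = inside-inside y y′ refl refl p q
  ... | inside y p | after z     =
    trans (inside-after y z refl p refl)
          (sym (bounded-outside g-bounded {y} {suc b + z} λ (_ , c<1+b) → m+n≮m (suc b) z c<1+b))
  ... | after z    | inside y q  = begin
    E (suc b + z) y          ≡⟨ after-inside z y refl refl q refl ⟩
    isMin g y ∧ at one (suc z) 0 ≡⟨ cong (isMin g y ∧_) (one-outside z {0}) ⟩
    isMin g y ∧ false        ≡⟨ ∧-zeroʳ (isMin g y) ⟩
    false                    ≡⟨ sym (g-row-outside z) ⟩
    g (suc b + z) y          ∎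
  ... | after z    | after z′    =
    trans (after-after z z′ refl refl refl refl) (trans (one-outside z {suc z′}) (sym (g-row-outside z)))

module _ {a : ℕ} {f : Entries} (Pf : IsPosetEntries (suc a) f) {i : ℕ} (i<1+a : i < suc a) where
  open Blocks f (at one) i 0
  open IsPosetEntries Pf

  compose-unitʳ : ∀ r c → E r c ≡ f r c
  compose-unitʳ r c with block i 0 r | block i 0 c
  ... | inside (suc _) (s≤s ()) | _
  ... | _          | inside (suc _) (s≤s ())
  ... | before p   | before q   = before-before p q
  ... | before p   | inside 0 _ =
    trans (before-inside 0 p refl) (sym (triangular _ _ (<-≤-trans p (m≤m+n i 0))))
  ... | before p   | after z    =
    trans (before-after z p refl) (sym (triangular _ _ (<-≤-trans p (i≤i+1+b+z i 0 z))))
  ... | inside 0 p | before q   = trans (inside-before 0 refl p q) (cong (λ k → f k c) (sym (+-identityʳ i)))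
  ... | inside 0 p | inside 0 q =
    trans (inside-inside 0 0 refl refl p q) (sym (reflexive (i + 0) (subst (_< suc a) (sym (+-identityʳ i)) i<1+a)))
  ... | inside 0 p | after z    =
    trans (inside-after 0 z refl p refl) (sym (triangular _ _ (<-≤-trans (+-monoʳ-< i z<s) (m≤m+n (i + 1) z))))
  ... | after z    | before q   = after-before z refl q (+-assoc i 1 z)
  ... | after z    | inside 0 q =
    trans (after-inside z 0 refl refl q (+-assoc i 1 z)) (cong (f (i + 1 + z)) (sym (+-identityʳ i)))
  ... | after z    | after z′   = after-after z z′ refl refl (+-assoc i 1 z) (+-assoc i 1 z′)

compMin-unitˡ : ∀ {a} (A : Mat (suc a)) → compMin one 0 A ≋ A
compMin-unitˡ A = refl , λ r c → trans (at-compMin one A z<s r c) (compose-unitˡ (at-bounded A) r c)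

compMin-unitʳ : ∀ {a} {A : Mat (suc a)} {i} → i < suc a → IsPM A → compMin A i one ≋ A
compMin-unitʳ {a} {A} i<1+a pmA = cong suc (+-identityʳ a) , λ r c →
  trans (at-compMin A one i<1+a r c) (compose-unitʳ (IsPM⇒IsPosetEntries pmA) i<1+a r c)

module _ (g h : Entries) (j c : ℕ) where
  open Blocks g h j c

  isMin-before : ∀ {y} → y < j → isMin E y ≡ isMin g y
  isMin-before {y} y<j = cong not (anyBelow-cong y λ t t<y → before-before y<j (<-trans t<y y<j))

  isMin-inside : ∀ {w} → w < suc c → isMin E (j + w) ≡ isMin g j ∧ isMin h w
  isMin-inside {w} w<1+c = begin
    not (anyBelow (E (j + w)) (j + w))
      ≡⟨ cong not (anyBelow-+ (E (j + w)) j w) ⟩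
    not (anyBelow (E (j + w)) j ∨ anyBelow (λ t → E (j + w) (j + t)) w)
      ≡⟨ cong not (cong₂ _∨_ (anyBelow-cong j λ t t<j → inside-before w refl w<1+c t<j)
                             (anyBelow-cong w λ t t<w → inside-inside w t refl refl w<1+c (<-trans t<w w<1+c))) ⟩
    not (anyBelow (g j) j ∨ anyBelow (h w) w)
      ≡⟨ not-∨ (anyBelow (g j) j) (anyBelow (h w) w) ⟩
    isMin g j ∧ isMin h w ∎

  -- As 0 is minimal in h, the h-block of this row contributes exactly the entry g k j.
  isMin-after : ∀ z → isMin E (j + suc c + z) ≡ isMin g (j + suc z)
  isMin-after z = cong not (begin
    anyBelow row (j + suc c + z)
      ≡⟨ anyBelow-+ row (j + suc c) z ⟩
    anyBelow row (j + suc c) ∨ rowᶜ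
      ≡⟨ cong (_∨ rowᶜ) (anyBelow-+ row j (suc c)) ⟩
    (anyBelow row j ∨ anyBelow (λ t → row (j + t)) (suc c)) ∨ rowᶜ
      ≡⟨ cong₂ _∨_ (cong₂ _∨_ (anyBelow-cong j λ t t<j → after-before z refl t<j refl) h-block)
                   (anyBelow-cong z λ t _ → after-after z t refl refl refl refl) ⟩
    (anyBelow (g k) j ∨ g k j) ∨ gᶜ
      ≡⟨ ∨-assoc (anyBelow (g k) j) _ _ ⟩
    anyBelow (g k) j ∨ (g k j ∨ gᶜ)
      ≡⟨ cong (λ x → anyBelow (g k) j ∨ (g k x ∨ gᶜ)) (sym (+-identityʳ j)) ⟩
    anyBelow (g k) j ∨ (g k (j + 0) ∨ gᶜ)
      ≡⟨ cong (anyBelow (g k) j ∨_) (sym (anyBelow-suc (λ t → g k (j + t)) z)) ⟩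
    anyBelow (g k) j ∨ anyBelow (λ t → g k (j + t)) (suc z)
      ≡⟨ sym (anyBelow-+ (g k) j (suc z)) ⟩
    anyBelow (g k) (j + suc z) ∎)
    where
    row : ℕ → Bool
    row = E (j + suc c + z)
    k : ℕ
    k = j + suc z
    rowᶜ gᶜ : Bool
    rowᶜ = anyBelow (λ t → row (j + suc c + t)) z
    gᶜ = anyBelow (λ t → g k (j + suc t)) z
    h-block : anyBelow (λ t → row (j + t)) (suc c) ≡ g k j
    h-block = trans (anyBelow-cong (suc c) λ t t<1+c → after-inside z t refl refl t<1+c refl)
                    (anyBelow-guarded (isMin h) (g k j) c refl)

data NestedBlock (i j d c : ℕ) : ℕ → Set where
  outer-before : ∀ {x} → x < i → NestedBlock i j d c x
  inner-before : ∀ y → y < j → NestedBlock i j d c (i + y)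
  innermost    : ∀ w → w < suc c → NestedBlock i j d c (i + (j + w))
  inner-after  : ∀ z → z < d → NestedBlock i j d c (i + (j + suc c + z))
  outer-after  : ∀ z → NestedBlock i j d c (i + suc (j + d + c) + z)

nestedBlock : ∀ i j d c r → NestedBlock i j d c r
nestedBlock i j d c r with block i (j + d + c) r
... | before x<i = outer-before x<i
... | after z    = outer-after z
... | inside y y<1+j+d+c with block j c y
...   | before y<j   = inner-before y y<j
...   | inside w w<1+c = innermost w w<1+c
...   | after z      = inner-after z
  (+-cancelˡ-≤ (j + c) (suc z) d (subst₂ _≤_ reorder₁ reorder₂ (s≤s⁻¹ y<1+j+d+c)))
  where
  reorder₁ : j + suc c + z ≡ (j + c) + suc z
  reorder₁ = solve (j ∷ c ∷ z ∷ [])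
  reorder₂ : j + d + c ≡ (j + c) + d
  reorder₂ = solve (j ∷ d ∷ c ∷ [])

-- B has order 1 + j + d, so d counts the indices of B after j.
module _ (f g h : Entries) (i j d c : ℕ) where
  private
    module F = Blocks f g i (j + d)
    module G = Blocks g h j c
    module L = Blocks (compose f g i (j + d)) h (i + j) c
    module R = Blocks f (compose g h j c) i (j + d + c)

    <i⇒<i+j : ∀ {x} → x < i → x < i + j
    <i⇒<i+j x<i = <-≤-trans x<i (m≤m+n i j)

    <j⇒<1+j+d : ∀ {y} → y < j → y < suc (j + d)
    <j⇒<1+j+d y<j = m<n⇒m<1+n (<-≤-trans y<j (m≤m+n j d))

    <j⇒<1+j+d+c : ∀ {y} → y < j → y < suc (j + d + c)
    <j⇒<1+j+d+c y<j = m<n⇒m<1+n (<-≤-trans y<j (≤-trans (m≤m+n j d) (m≤m+n (j + d) c)))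

    j<1+j+d : j < suc (j + d)
    j<1+j+d = s≤s (m≤m+n j d)

    j+w<1+j+d+c : ∀ {w} → w < suc c → j + w < suc (j + d + c)
    j+w<1+j+d+c {w} w<1+c =
      s≤s (subst (j + w ≤_) (sym (+-assoc j d c)) (+-monoʳ-≤ j (≤-trans (s≤s⁻¹ w<1+c) (m≤n+m c d))))

    j+1+c+z<1+j+d+c : ∀ {z} → z < d → j + suc c + z < suc (j + d + c)
    j+1+c+z<1+j+d+c {z} z<d = s≤s (subst₂ _≤_ reorder₁ reorder₂ (+-monoʳ-≤ (j + c) z<d))
      where
      reorder₁ : j + c + suc z ≡ j + suc c + z
      reorder₁ = solve (j ∷ c ∷ z ∷ [])
      reorder₂ : j + c + d ≡ j + d + c
      reorder₂ = solve (j ∷ c ∷ d ∷ [])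

    j+1+z<1+j+d : ∀ {z} → z < d → j + suc z < suc (j + d)
    j+1+z<1+j+d z<d = s≤s (+-monoʳ-≤ j z<d)

    L-innermost : ∀ w → i + (j + w) ≡ i + j + w
    L-innermost w = sym (+-assoc i j w)

    L-inner-after : ∀ z → i + (j + suc c + z) ≡ i + j + suc c + z
    L-inner-after z = solve (i ∷ j ∷ c ∷ z ∷ [])

    L-outer-after : ∀ z → i + suc (j + d + c) + z ≡ i + j + suc c + (d + z)
    L-outer-after z = solve (i ∷ j ∷ d ∷ c ∷ z ∷ [])

    L-inner-after-row : ∀ z → i + (j + suc z) ≡ i + j + suc z
    L-inner-after-row z = sym (+-assoc i j (suc z))

    L-outer-after-row : ∀ z → i + suc (j + d) + z ≡ i + j + suc (d + z)
    L-outer-after-row z = solve (i ∷ j ∷ d ∷ z ∷ [])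

  compose-assoc′ : ∀ r x → compose (compose f g i (j + d)) h (i + j) c r x ≡
                           compose f (compose g h j c) i (j + d + c) r x
  compose-assoc′ r x with nestedBlock i j d c r | nestedBlock i j d c x
  ... | outer-before p | outer-before q =
    trans (trans (L.before-before (<i⇒<i+j p) (<i⇒<i+j q)) (F.before-before p q)) (sym (R.before-before p q))
  ... | outer-before p | inner-before y q =
    trans (trans (L.before-before (<i⇒<i+j p) (+-monoʳ-< i q)) (F.before-inside y p refl))
          (sym (R.before-inside y p refl))
  ... | outer-before p | innermost w q =
    trans (L.before-inside w (<i⇒<i+j p) (L-innermost w)) (sym (R.before-inside (j + w) p refl))
  ... | outer-before p | inner-after z q =
    trans (L.before-after z (<i⇒<i+j p) (L-inner-after z)) (sym (R.before-inside (j + suc c + z) p refl))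
  ... | outer-before p | outer-after z =
    trans (L.before-after (d + z) (<i⇒<i+j p) (L-outer-after z)) (sym (R.before-after z p refl))
  ... | inner-before y p | outer-before q =
    trans (trans (L.before-before (+-monoʳ-< i p) (<i⇒<i+j q)) (F.inside-before y refl (<j⇒<1+j+d p) q))
          (sym (R.inside-before y refl (<j⇒<1+j+d+c p) q))
  ... | inner-before y p | inner-before y′ q =
    trans (trans (L.before-before (+-monoʳ-< i p) (+-monoʳ-< i q))
                 (F.inside-inside y y′ refl refl (<j⇒<1+j+d p) (<j⇒<1+j+d q)))
          (sym (trans (R.inside-inside y y′ refl refl (<j⇒<1+j+d+c p) (<j⇒<1+j+d+c q)) (G.before-before p q)))
  ... | inner-before y p | innermost w q =
    trans (L.before-inside w (+-monoʳ-< i p) (L-innermost w))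
          (sym (trans (R.inside-inside y (j + w) refl refl (<j⇒<1+j+d+c p) (j+w<1+j+d+c q))
                      (G.before-inside w p refl)))
  ... | inner-before y p | inner-after z q =
    trans (L.before-after z (+-monoʳ-< i p) (L-inner-after z))
          (sym (trans (R.inside-inside y (j + suc c + z) refl refl (<j⇒<1+j+d+c p) (j+1+c+z<1+j+d+c q))
                      (G.before-after z p refl)))
  ... | inner-before y p | outer-after z =
    trans (L.before-after (d + z) (+-monoʳ-< i p) (L-outer-after z))
          (sym (R.inside-after y z refl (<j⇒<1+j+d+c p) refl))
  ... | innermost w p | outer-before q =
    trans (trans (L.inside-before w (L-innermost w) p (<i⇒<i+j q)) (F.inside-before j refl j<1+j+d q))
          (sym (R.inside-before (j + w) refl (j+w<1+j+d+c p) q))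
  ... | innermost w p | inner-before y q =
    trans (trans (L.inside-before w (L-innermost w) p (+-monoʳ-< i q))
                 (F.inside-inside j y refl refl j<1+j+d (<j⇒<1+j+d q)))
          (sym (trans (R.inside-inside (j + w) y refl refl (j+w<1+j+d+c p) (<j⇒<1+j+d+c q))
                      (G.inside-before w refl p q)))
  ... | innermost w p | innermost w′ q =
    trans (L.inside-inside w w′ (L-innermost w) (L-innermost w′) p q)
          (sym (trans (R.inside-inside (j + w) (j + w′) refl refl (j+w<1+j+d+c p) (j+w<1+j+d+c q))
                      (G.inside-inside w w′ refl refl p q)))
  ... | innermost w p | inner-after z q =
    trans (L.inside-after w z (L-innermost w) p (L-inner-after z))
          (sym (trans (R.inside-inside (j + w) (j + suc c + z) refl refl (j+w<1+j+d+c p) (j+1+c+z<1+j+d+c q))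
                      (G.inside-after w z refl p refl)))
  ... | innermost w p | outer-after z =
    trans (L.inside-after w (d + z) (L-innermost w) p (L-outer-after z))
          (sym (R.inside-after (j + w) z refl (j+w<1+j+d+c p) refl))
  ... | inner-after z p | outer-before q =
    trans (trans (L.after-before z (L-inner-after z) (<i⇒<i+j q) (L-inner-after-row z))
                 (F.inside-before (j + suc z) refl (j+1+z<1+j+d p) q))
          (sym (R.inside-before (j + suc c + z) refl (j+1+c+z<1+j+d+c p) q))
  ... | inner-after z p | inner-before y q =
    trans (trans (L.after-before z (L-inner-after z) (+-monoʳ-< i q) (L-inner-after-row z))
                 (F.inside-inside (j + suc z) y refl refl (j+1+z<1+j+d p) (<j⇒<1+j+d q)))
          (sym (trans (R.inside-inside (j + suc c + z) y refl refl (j+1+c+z<1+j+d+c p) (<j⇒<1+j+d+c q))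
                      (G.after-before z refl q refl)))
  ... | inner-after z p | innermost w q =
    trans (trans (L.after-inside z w (L-inner-after z) (L-innermost w) q (L-inner-after-row z))
                 (cong (isMin h w ∧_) (F.inside-inside (j + suc z) j refl refl (j+1+z<1+j+d p) j<1+j+d)))
          (sym (trans (R.inside-inside (j + suc c + z) (j + w) refl refl (j+1+c+z<1+j+d+c p) (j+w<1+j+d+c q))
                      (G.after-inside z w refl refl q refl)))
  ... | inner-after z p | inner-after z′ q =
    trans (trans (L.after-after z z′ (L-inner-after z) (L-inner-after z′)
                                     (L-inner-after-row z) (L-inner-after-row z′))
                 (F.inside-inside (j + suc z) (j + suc z′) refl refl (j+1+z<1+j+d p) (j+1+z<1+j+d q)))
          (sym (trans (R.inside-inside (j + suc c + z) (j + suc c + z′) refl refl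
                                       (j+1+c+z<1+j+d+c p) (j+1+c+z<1+j+d+c q))
                      (G.after-after z z′ refl refl refl refl)))
  ... | inner-after z p | outer-after z′ =
    trans (trans (L.after-after z (d + z′) (L-inner-after z) (L-outer-after z′)
                                          (L-inner-after-row z) (L-outer-after-row z′))
                 (F.inside-after (j + suc z) z′ refl (j+1+z<1+j+d p) refl))
          (sym (R.inside-after (j + suc c + z) z′ refl (j+1+c+z<1+j+d+c p) refl))
  ... | outer-after z | outer-before q =
    trans (trans (L.after-before (d + z) (L-outer-after z) (<i⇒<i+j q) (L-outer-after-row z))
                 (F.after-before z refl q refl))
          (sym (R.after-before z refl q refl))
  ... | outer-after z | inner-before y q =
    trans (trans (L.after-before (d + z) (L-outer-after z) (+-monoʳ-< i q) (L-outer-after-row z))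
                 (F.after-inside z y refl refl (<j⇒<1+j+d q) refl))
          (sym (trans (R.after-inside z y refl refl (<j⇒<1+j+d+c q) refl)
                      (cong (_∧ f (i + suc z) i) (isMin-before g h j c q))))
  ... | outer-after z | innermost w q =
    trans (trans (L.after-inside (d + z) w (L-outer-after z) (L-innermost w) q (L-outer-after-row z))
                 (trans (cong (isMin h w ∧_) (F.after-inside z j refl refl j<1+j+d refl))
                        (trans (sym (∧-assoc (isMin h w) (isMin g j) _))
                               (cong (_∧ f (i + suc z) i) (∧-comm (isMin h w) (isMin g j))))))
          (sym (trans (R.after-inside z (j + w) refl refl (j+w<1+j+d+c q) refl)
                      (cong (_∧ f (i + suc z) i) (isMin-inside g h j c q))))
  ... | outer-after z | inner-after z′ q =
    trans (trans (L.after-after (d + z) z′ (L-outer-after z) (L-inner-after z′)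
                                          (L-outer-after-row z) (L-inner-after-row z′))
                 (F.after-inside z (j + suc z′) refl refl (j+1+z<1+j+d q) refl))
          (sym (trans (R.after-inside z (j + suc c + z′) refl refl (j+1+c+z<1+j+d+c q) refl)
                      (cong (_∧ f (i + suc z) i) (isMin-after g h j c z′))))
  ... | outer-after z | outer-after z′ =
    trans (trans (L.after-after (d + z) (d + z′) (L-outer-after z) (L-outer-after z′)
                                                (L-outer-after-row z) (L-outer-after-row z′))
                 (F.after-after z z′ refl refl refl refl))
          (sym (R.after-after z z′ refl refl refl refl))

compose-assoc : ∀ f g h i {j b} c → j < suc b →
                ∀ r x → compose (compose f g i b) h (i + j) c r x ≡ compose f (compose g h j c) i (b + c) r x
compose-assoc f g h i {j} c j<1+b with m≤n⇒∃[o]m+o≡n (s≤s⁻¹ j<1+b)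
... | d , refl = compose-assoc′ f g h i j d c

data DisjointBlock (i b e c : ℕ) : ℕ → Set where
  before-B : ∀ {x} → x < i → DisjointBlock i b e c x
  in-B     : ∀ y → y < suc b → DisjointBlock i b e c (i + y)
  between  : ∀ z → z < e → DisjointBlock i b e c (i + suc b + z)
  in-C     : ∀ w → w < suc c → DisjointBlock i b e c (i + suc b + (e + w))
  after-C  : ∀ z → DisjointBlock i b e c (i + suc b + (e + suc c + z))

disjointBlock : ∀ i b e c r → DisjointBlock i b e c r
disjointBlock i b e c r with block i b r
... | before x<i   = before-B x<i
... | inside y y<1+b = in-B y y<1+b
... | after z with block e c z
...   | before z<e   = between z z<e
...   | inside w w<1+c = in-C w w<1+c
...   | after z′     = after-C z′

-- C is inserted at j = i + 1 + e, so e counts the indices of A strictly between i and j.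
module _ (f g h : Entries) (i e b c : ℕ) where
  private
    j : ℕ
    j = i + suc e
    module F = Blocks f g i b
    module H = Blocks f h j c
    module L = Blocks (compose f g i b) h (j + b) c
    module R = Blocks (compose f h j c) g i b

    F-j+b : i + suc e + b ≡ i + suc b + e
    F-j+b = solve (i ∷ b ∷ e ∷ [])

    F-after-C-row : ∀ z → i + suc e + suc z ≡ i + suc (e + suc z)
    F-after-C-row z = solve (i ∷ e ∷ z ∷ [])

    H-in-C : ∀ w → i + suc (e + w) ≡ i + suc e + w
    H-in-C w = solve (i ∷ e ∷ w ∷ [])

    H-after-C : ∀ z → i + suc (e + suc c + z) ≡ i + suc e + suc c + z
    H-after-C z = solve (i ∷ e ∷ c ∷ z ∷ [])

    L-in-C : ∀ w → i + suc b + (e + w) ≡ i + suc e + b + w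
    L-in-C w = solve (i ∷ b ∷ e ∷ w ∷ [])

    L-after-C : ∀ z → i + suc b + (e + suc c + z) ≡ i + suc e + b + suc c + z
    L-after-C z = solve (i ∷ b ∷ e ∷ c ∷ z ∷ [])

    L-after-C-row : ∀ z → i + suc b + (e + suc z) ≡ i + suc e + b + suc z
    L-after-C-row z = solve (i ∷ b ∷ e ∷ z ∷ [])

    i<j : i < j
    i<j = m<m+n i z<s

    <i⇒<j : ∀ {x} → x < i → x < j
    <i⇒<j x<i = <-trans x<i i<j

    i+1+z<j : ∀ {z} → z < e → i + suc z < j
    i+1+z<j z<e = +-monoʳ-< i (s≤s z<e)

    <i⇒<j+b : ∀ {x} → x < i → x < j + b
    <i⇒<j+b x<i = <-≤-trans (<i⇒<j x<i) (m≤m+n j b)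

    i+y<j+b : ∀ {y} → y < suc b → i + y < j + b
    i+y<j+b y<1+b = <-≤-trans (+-monoʳ-< i y<1+b) (≤-trans (m≤m+n (i + suc b) e) (≤-reflexive (sym F-j+b)))

    i+1+b+z<j+b : ∀ {z} → z < e → i + suc b + z < j + b
    i+1+b+z<j+b z<e = <-≤-trans (+-monoʳ-< (i + suc b) z<e) (≤-reflexive (sym F-j+b))

  compose-interchange′ : ∀ r x → compose (compose f g i b) h (j + b) c r x ≡ compose (compose f h j c) g i b r x
  compose-interchange′ r x with disjointBlock i b e c r | disjointBlock i b e c x
  ... | before-B p | before-B q =
    trans (trans (L.before-before (<i⇒<j+b p) (<i⇒<j+b q)) (F.before-before p q))
          (sym (trans (R.before-before p q) (H.before-before (<i⇒<j p) (<i⇒<j q))))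
  ... | before-B p | in-B y q =
    trans (trans (L.before-before (<i⇒<j+b p) (i+y<j+b q)) (F.before-inside y p refl))
          (sym (R.before-inside y p refl))
  ... | before-B p | between z q =
    trans (trans (L.before-before (<i⇒<j+b p) (i+1+b+z<j+b q)) (F.before-after z p refl))
          (sym (R.before-after z p refl))
  ... | before-B p | in-C w q =
    trans (L.before-inside w (<i⇒<j+b p) (L-in-C w)) (sym (R.before-after (e + w) p refl))
  ... | before-B p | after-C z =
    trans (L.before-after z (<i⇒<j+b p) (L-after-C z)) (sym (R.before-after (e + suc c + z) p refl))
  ... | in-B y p | before-B q =
    trans (trans (L.before-before (i+y<j+b p) (<i⇒<j+b q)) (F.inside-before y refl p q))
          (sym (trans (R.inside-before y refl p q) (H.before-before i<j (<i⇒<j q))))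
  ... | in-B y p | in-B y′ q =
    trans (trans (L.before-before (i+y<j+b p) (i+y<j+b q)) (F.inside-inside y y′ refl refl p q))
          (sym (R.inside-inside y y′ refl refl p q))
  ... | in-B y p | between z q =
    trans (trans (L.before-before (i+y<j+b p) (i+1+b+z<j+b q)) (F.inside-after y z refl p refl))
          (sym (R.inside-after y z refl p refl))
  ... | in-B y p | in-C w q =
    trans (L.before-inside w (i+y<j+b p) (L-in-C w)) (sym (R.inside-after y (e + w) refl p refl))
  ... | in-B y p | after-C z =
    trans (L.before-after z (i+y<j+b p) (L-after-C z)) (sym (R.inside-after y (e + suc c + z) refl p refl))
  ... | between z p | before-B q =
    trans (trans (L.before-before (i+1+b+z<j+b p) (<i⇒<j+b q)) (F.after-before z refl q refl))
          (sym (trans (R.after-before z refl q refl) (H.before-before (i+1+z<j p) (<i⇒<j q))))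
  ... | between z p | in-B y q =
    trans (trans (L.before-before (i+1+b+z<j+b p) (i+y<j+b q)) (F.after-inside z y refl refl q refl))
          (sym (trans (R.after-inside z y refl refl q refl)
                      (cong (isMin g y ∧_) (H.before-before (i+1+z<j p) i<j))))
  ... | between z p | between z′ q =
    trans (trans (L.before-before (i+1+b+z<j+b p) (i+1+b+z<j+b q)) (F.after-after z z′ refl refl refl refl))
          (sym (trans (R.after-after z z′ refl refl refl refl) (H.before-before (i+1+z<j p) (i+1+z<j q))))
  ... | between z p | in-C w q =
    trans (L.before-inside w (i+1+b+z<j+b p) (L-in-C w))
          (sym (trans (R.after-after z (e + w) refl refl refl refl) (H.before-inside w (i+1+z<j p) (H-in-C w))))
  ... | between z p | after-C z′ =
    trans (L.before-after z′ (i+1+b+z<j+b p) (L-after-C z′))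
          (sym (trans (R.after-after z (e + suc c + z′) refl refl refl refl)
                      (H.before-after z′ (i+1+z<j p) (H-after-C z′))))
  ... | in-C w p | before-B q =
    trans (trans (L.inside-before w (L-in-C w) p (<i⇒<j+b q)) (F.after-before e F-j+b q refl))
          (sym (trans (R.after-before (e + w) refl q refl) (H.inside-before w (H-in-C w) p (<i⇒<j q))))
  ... | in-C w p | in-B y q =
    trans (trans (L.inside-before w (L-in-C w) p (i+y<j+b q)) (F.after-inside e y F-j+b refl q refl))
          (sym (trans (R.after-inside (e + w) y refl refl q refl)
                      (cong (isMin g y ∧_) (H.inside-before w (H-in-C w) p i<j))))
  ... | in-C w p | between z q =
    trans (trans (L.inside-before w (L-in-C w) p (i+1+b+z<j+b q)) (F.after-after e z F-j+b refl refl refl))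
          (sym (trans (R.after-after (e + w) z refl refl refl refl) (H.inside-before w (H-in-C w) p (i+1+z<j q))))
  ... | in-C w p | in-C w′ q =
    trans (L.inside-inside w w′ (L-in-C w) (L-in-C w′) p q)
          (sym (trans (R.after-after (e + w) (e + w′) refl refl refl refl)
                      (H.inside-inside w w′ (H-in-C w) (H-in-C w′) p q)))
  ... | in-C w p | after-C z =
    trans (L.inside-after w z (L-in-C w) p (L-after-C z))
          (sym (trans (R.after-after (e + w) (e + suc c + z) refl refl refl refl)
                      (H.inside-after w z (H-in-C w) p (H-after-C z))))
  ... | after-C z | before-B q =
    trans (trans (L.after-before z (L-after-C z) (<i⇒<j+b q) (L-after-C-row z))
                 (F.after-before (e + suc z) refl q (F-after-C-row z)))
          (sym (trans (R.after-before (e + suc c + z) refl q refl)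
                      (H.after-before z (H-after-C z) (<i⇒<j q) refl)))
  ... | after-C z | in-B y q =
    trans (trans (L.after-before z (L-after-C z) (i+y<j+b q) (L-after-C-row z))
                 (F.after-inside (e + suc z) y refl refl q (F-after-C-row z)))
          (sym (trans (R.after-inside (e + suc c + z) y refl refl q refl)
                      (cong (isMin g y ∧_) (H.after-before z (H-after-C z) i<j refl))))
  ... | after-C z | between z′ q =
    trans (trans (L.after-before z (L-after-C z) (i+1+b+z<j+b q) (L-after-C-row z))
                 (F.after-after (e + suc z) z′ refl refl (F-after-C-row z) refl))
          (sym (trans (R.after-after (e + suc c + z) z′ refl refl refl refl)
                      (H.after-before z (H-after-C z) (i+1+z<j q) refl)))
  ... | after-C z | in-C w q =
    trans (trans (L.after-inside z w (L-after-C z) (L-in-C w) q (L-after-C-row z))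
                 (cong (isMin h w ∧_) (F.after-after (e + suc z) e refl F-j+b (F-after-C-row z) refl)))
          (sym (trans (R.after-after (e + suc c + z) (e + w) refl refl refl refl)
                      (H.after-inside z w (H-after-C z) (H-in-C w) q refl)))
  ... | after-C z | after-C z′ =
    trans (trans (L.after-after z z′ (L-after-C z) (L-after-C z′) (L-after-C-row z) (L-after-C-row z′))
                 (F.after-after (e + suc z) (e + suc z′) refl refl (F-after-C-row z) (F-after-C-row z′)))
          (sym (trans (R.after-after (e + suc c + z) (e + suc c + z′) refl refl refl refl)
                      (H.after-after z z′ (H-after-C z) (H-after-C z′) refl refl)))

compose-interchange : ∀ f g h {i j} b c → i < j →
                      ∀ r x → compose (compose f g i b) h (j + b) c r x ≡ compose (compose f h j c) g i b r x
compose-interchange f g h {i} b c i<j with m≤n⇒∃[o]m+o≡n i<j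
... | e , refl =
  subst (λ j → ∀ r x → compose (compose f g i b) h (j + b) c r x ≡ compose (compose f h j c) g i b r x)
                       (+-suc i e) (compose-interchange′ f g h i e b c)

compMin-assoc : ∀ {a b c} (A : Mat (suc a)) (B : Mat (suc b)) (C : Mat (suc c)) {i j} → i < suc a → j < suc b →
                compMin (compMin A i B) (i + j) C ≋ compMin A i (compMin B j C)
compMin-assoc {a} {b} {c} A B C {i} {j} i<1+a j<1+b = cong suc (+-assoc a b c) , λ r x → begin
  at (compMin (compMin A i B) (i + j) C) r x
    ≡⟨ at-compMin (compMin A i B) C (s≤s (+-mono-≤ (s≤s⁻¹ i<1+a) (s≤s⁻¹ j<1+b))) r x ⟩
  compose (at (compMin A i B)) (at C) (i + j) c r x
    ≡⟨ compose-congˡ (at C) (i + j) c (at-compMin A B i<1+a) r x ⟩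
  compose (compose (at A) (at B) i b) (at C) (i + j) c r x
    ≡⟨ compose-assoc (at A) (at B) (at C) i c j<1+b r x ⟩
  compose (at A) (compose (at B) (at C) j c) i (b + c) r x
    ≡⟨ compose-congʳ (at A) i (b + c) (at-compMin B C j<1+b) r x ⟨
  compose (at A) (at (compMin B j C)) i (b + c) r x
    ≡⟨ at-compMin A (compMin B j C) i<1+a r x ⟨
  at (compMin A i (compMin B j C)) r x ∎

compMin-interchange : ∀ {a b c} (A : Mat (suc a)) (B : Mat (suc b)) (C : Mat (suc c)) {i j} → i < j → j < suc a →
                      compMin (compMin A i B) (j + b) C ≋ compMin (compMin A j C) i B
compMin-interchange {a} {b} {c} A B C {i} {j} i<j j<1+a = solve (a ∷ b ∷ c ∷ []) , λ r x → begin
  at (compMin (compMin A i B) (j + b) C) r x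
    ≡⟨ at-compMin (compMin A i B) C (s≤s (+-monoˡ-≤ b (s≤s⁻¹ j<1+a))) r x ⟩
  compose (at (compMin A i B)) (at C) (j + b) c r x
    ≡⟨ compose-congˡ (at C) (j + b) c (at-compMin A B i<1+a) r x ⟩
  compose (compose (at A) (at B) i b) (at C) (j + b) c r x
    ≡⟨ compose-interchange (at A) (at B) (at C) b c i<j r x ⟩
  compose (compose (at A) (at C) j c) (at B) i b r x
    ≡⟨ compose-congˡ (at B) i b (at-compMin A C j<1+a) r x ⟨
  compose (at (compMin A j C)) (at B) i b r x
    ≡⟨ at-compMin (compMin A j C) B (<-≤-trans i<1+a (s≤s (m≤m+n a c))) r x ⟨
  at (compMin (compMin A j C) i B) r x ∎
  where
  i<1+a : i < suc a
  i<1+a = <-trans i<j j<1+a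

theorem3 :
    (∀ a b (A : Mat (suc a)) (B : Mat (suc b)) (i : ℕ) → i < suc a →
       IsPM A → IsPM B → IsPM (compMin A i B)) ×
    (∀ a b c (A : Mat (suc a)) (B : Mat (suc b)) (C : Mat (suc c)) (i j : ℕ) →
       i < suc a → j < suc b → IsPM A → IsPM B → IsPM C →
       compMin (compMin A i B) (i + j) C ≋ compMin A i (compMin B j C)) ×
    (∀ a b c (A : Mat (suc a)) (B : Mat (suc b)) (C : Mat (suc c)) (i j : ℕ) →
       i < j → j < suc a → IsPM A → IsPM B → IsPM C →
       compMin (compMin A i B) (j + b) C ≋ compMin (compMin A j C) i B) ×
    (∀ a (A : Mat (suc a)) (i : ℕ) → i < suc a → IsPM A →
       (compMin one 0 A ≋ A) × (compMin A i one ≋ A))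
theorem3 =
  (λ _ _ _ _ _ i<1+a pmA pmB → compMin-isPM i<1+a pmA pmB) ,
  (λ _ _ _ A B C _ _ i<1+a j<1+b _ _ _ → compMin-assoc A B C i<1+a j<1+b) ,
  (λ _ _ _ A B C _ _ i<j j<1+a _ _ _ → compMin-interchange A B C i<j j<1+a) ,
  (λ _ A _ i<1+a pmA → compMin-unitˡ A , compMin-unitʳ i<1+a pmA)
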